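{- Let $\mathcal G$ be the graph with vertex set $V=(\mathbb{N}\times\mathbb{N})\setminus\{(0,0)\}$ (where $\mathbb{N}=\{0,1,2,\dots\}$), in which two distinct vertices $(a,b),(c,d)$ are adjacent if and only if $a=c=0$, or $b=d=0$, or ($a<c$ and $b>d$), or ($a>c$ and $b<d$). Then $\mathcal G$ is cop-win. Furthermore, for any two vertices $u,v$ of $\mathcal G$ there exists $n\in\mathbb{N}$ such that if the cop is at $v$ and the robber is at $u$, with the robber to make the next move, the cop can catch the robber in at most $n$ turns. However, there is no $n\in\mathbb{N}$ such that this holds for all pairs of positions $u,v$.
   Context: The game of cops and robbers on a graph $G$: the cop chooses a starting vertex, then the robber chooses a starting vertex; then they alternately move, the cop moving first, where a move consists of moving to an adjacent vertex or staying put. The cop wins if at some point he occupies the same vertex as the robber. $G$ is cop-win if the cop has a winning strategy. -}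

module Defs where

open import Data.Nat using (ℕ; zero; suc; _+_; _<_; _>_; NonZero)
open import Data.Product using (Σ; _×_; _,_; proj₁; proj₂; ∃)
open import Data.Sum using (_⊎_)
open import Data.Empty using (⊥)
open import Data.Vec using (Vec; []; _∷_)
open import Relation.Nullary using (¬_)
open import Relation.Binary.PropositionalEquality using (_≡_; _≢_)

-- Vertex set V = (ℕ × ℕ) ∖ {(0,0)}.  The side condition NonZero (a + b)
-- unfolds to a unit type, so it is definitionally proof-irrelevant.
V : Set
V = Σ (ℕ × ℕ) (λ p → NonZero (proj₁ p + proj₂ p))

xc : V → ℕ
xc u = proj₁ (proj₁ u)

yc : V → ℕ
yc u = proj₂ (proj₁ u)

Adj : V → V → Set
Adj u v = u ≢ v ×
  ( (xc u ≡ 0 × xc v ≡ 0)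
  ⊎ (yc u ≡ 0 × yc v ≡ 0)
  ⊎ (xc u < xc v × yc u > yc v)
  ⊎ (xc u > xc v × yc u < yc v) )

Move : V → V → Set
Move u w = u ≡ w ⊎ Adj u w

-- The game from the start (cop chooses c₀, robber chooses r₀, then
-- cop moves, robber moves, ...).  Positions: c₀, r₀, c₁, r₁, c₂, ...
-- A cop strategy gives c_n as a function of the robber's positions so
-- far, r_{n-1} ∷ ... ∷ r₀ (most recent first); σ 0 [] is c₀.

CopStrategy : Set
CopStrategy = (n : ℕ) → Vec V n → V

LegalCop : CopStrategy → Set
LegalCop σ = ∀ n (r : V) (h : Vec V n) → Move (σ n h) (σ (suc n) (r ∷ h))

RobberPlay : Set
RobberPlay = ℕ → V

LegalRobber : RobberPlay → Set
LegalRobber r = ∀ n → Move (r n) (r (suc n))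

hist : RobberPlay → (n : ℕ) → Vec V n
hist r zero = []
hist r (suc n) = r n ∷ hist r n

copAt : CopStrategy → RobberPlay → ℕ → V
copAt σ r n = σ n (hist r n)

-- capture at some point: c_n = r_n (after the robber's n-th placement/move)
-- or c_{n+1} = r_n (after the cop's move)
Caught : CopStrategy → RobberPlay → Set
Caught σ r = ∃ λ n → copAt σ r n ≡ r n ⊎ copAt σ r (suc n) ≡ r n

CopWin : Set
CopWin = Σ CopStrategy λ σ → LegalCop σ × (∀ r → LegalRobber r → Caught σ r)

-- RobberToMove n c r : cop at c,
-- robber at r, robber to move; the cop can catch the robber using at
-- most n cop moves.  CopToMove n c r : same with the cop to move.

mutual
  RobberToMove : ℕ → V → V → Set
  RobberToMove n c r = ∀ r′ → Move r r′ → r′ ≡ c ⊎ CopToMove n c r′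

  CopToMove : ℕ → V → V → Set
  CopToMove zero c r = ⊥
  CopToMove (suc n) c r = ∃ λ c′ → Move c c′ × (c′ ≡ r ⊎ RobberToMove n c′ r)

CatchWithin : ℕ → V → V → Set
CatchWithin n v u = u ≡ v ⊎ RobberToMove n v u

{-# OPTIONS --safe #-}
module Submission where

-- Off the axes, adjacency in 𝒢 is strict incomparability in the product order
-- on ℕ × ℕ.  A cop at (0, k + 1) therefore reaches, in one move, every vertex
-- on the y-axis or below height k + 1; a robber who avoids this must climb above
-- height k + 1, which off the axis is a strictly leftward move.  The cop follows
-- him along the y-axis, and the robber's x-coordinate is a clock running down.
-- After one move from (a, b) some coordinate of the robber is at most a + b, so
-- a first cop move high onto the y-axis (or, symmetrically, the x-axis) bounds
-- the clock.  Conversely, a robber at (m, m) can always step to a vertex the cop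
-- cannot reach while losing at most one unit in each coordinate, so he survives
-- roughly m rounds.

open import Defs
open import Data.Nat using (ℕ; zero; suc; _+_; _<_; _>_; _≤_; z≤n; s≤s; z<s; NonZero)
open import Data.Nat.Properties
open import Data.Product using (_×_; ∃; _,_; proj₁; proj₂)
open import Data.Sum using (_⊎_; inj₁; inj₂; [_,_]′)
open import Data.Vec using ([]; _∷_)
open import Function using (_∘_)
open import Relation.Nullary using (¬_; Dec; yes; no; contradiction)
open import Relation.Binary.PropositionalEquality

NonZero-irrelevant : ∀ n (p q : NonZero n) → p ≡ q
NonZero-irrelevant (suc n) p q = refl

V-≡ : ∀ {u v : V} → proj₁ u ≡ proj₁ v → u ≡ v
V-≡ {(p , q)} {(.p , q′)} refl = cong (p ,_) (NonZero-irrelevant _ q q′)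

_≟V_ : (u v : V) → Dec (u ≡ v)
u ≟V v with xc u ≟ xc v | yc u ≟ yc v
... | yes x≡ | yes y≡ = yes (V-≡ (cong₂ _,_ x≡ y≡))
... | no x≢ | _ = no (x≢ ∘ cong xc)
... | _ | no y≢ = no (y≢ ∘ cong yc)

Incomparable : V → V → Set
Incomparable u v = (xc u < xc v × yc u > yc v) ⊎ (xc u > xc v × yc u < yc v)

Near : V → V → Set
Near u v = (xc u ≡ 0 × xc v ≡ 0) ⊎ (yc u ≡ 0 × yc v ≡ 0) ⊎ Incomparable u v

Near⇒Move : ∀ {u v} → Near u v → Move u v
Near⇒Move {u} {v} near with u ≟V v
... | yes u≡v = inj₁ u≡v
... | no u≢v = inj₂ (u≢v , near)

Near-interior : ∀ {u v} → 0 < xc v → 0 < yc v → Near u v → Incomparable u v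
Near-interior x>0 _ (inj₁ (_ , x≡0)) = contradiction x≡0 (>⇒≢ x>0)
Near-interior _ y>0 (inj₂ (inj₁ (_ , y≡0))) = contradiction y≡0 (>⇒≢ y>0)
Near-interior _ _ (inj₂ (inj₂ incomparable)) = incomparable

Move-up⇒left : ∀ {r r′} → Move r r′ → 0 < xc r′ → yc r < yc r′ → xc r′ < xc r
Move-up⇒left (inj₁ refl) _ up = contradiction up (<-irrefl refl)
Move-up⇒left {r} {r′} (inj₂ (_ , near)) x>0 up with Near-interior {r} {r′} x>0 (≤-<-trans z≤n up) near
... | inj₁ (_ , down) = contradiction up (<-asym down)
... | inj₂ (left , _) = left

_≼_ : V → V → Set
u ≼ v = xc u ≤ xc v × yc u ≤ yc v

comparable⇒¬Move : ∀ {u v} → 0 < xc v → 0 < yc v → u ≢ v → u ≼ v ⊎ v ≼ u → ¬ Move u v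
comparable⇒¬Move _ _ u≢v _ (inj₁ u≡v) = u≢v u≡v
comparable⇒¬Move {u} {v} x>0 y>0 _ cmp (inj₂ (_ , near)) with Near-interior {u} {v} x>0 y>0 near | cmp
... | inj₁ (_ , y>) | inj₁ (_ , y≤) = <⇒≱ y> y≤
... | inj₁ (x< , _) | inj₂ (x≤ , _) = <⇒≱ x< x≤
... | inj₂ (x> , _) | inj₁ (x≤ , _) = <⇒≱ x> x≤
... | inj₂ (_ , y<) | inj₂ (_ , y≤) = <⇒≱ y< y≤

Move-bounded : ∀ {u u′} → Move u u′ → xc u′ ≤ xc u + yc u ⊎ yc u′ ≤ xc u + yc u
Move-bounded {u} (inj₁ refl) = inj₁ (m≤m+n (xc u) (yc u))
Move-bounded (inj₂ (_ , inj₁ (_ , x≡0))) rewrite x≡0 = inj₁ z≤n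
Move-bounded (inj₂ (_ , inj₂ (inj₁ (_ , y≡0)))) rewrite y≡0 = inj₂ z≤n
Move-bounded {u} (inj₂ (_ , inj₂ (inj₂ (inj₁ (_ , y>))))) = inj₂ (≤-trans (<⇒≤ y>) (m≤n+m (yc u) (xc u)))
Move-bounded {u} (inj₂ (_ , inj₂ (inj₂ (inj₂ (x> , _))))) = inj₁ (≤-trans (<⇒≤ x>) (m≤m+n (xc u) (yc u)))

swap : V → V
swap u = (yc u , xc u) , subst NonZero (+-comm (xc u) (yc u)) (proj₂ u)

swap-involutive : ∀ u → swap (swap u) ≡ u
swap-involutive u = V-≡ refl

swap-injective : ∀ {u v} → swap u ≡ swap v → u ≡ v
swap-injective {u} {v} eq = begin
  u               ≡⟨ swap-involutive u ⟨
  swap (swap u)   ≡⟨ cong swap eq ⟩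
  swap (swap v)   ≡⟨ swap-involutive v ⟩
  v               ∎
  where open ≡-Reasoning

swap-Near : ∀ {u v} → Near u v → Near (swap u) (swap v)
swap-Near (inj₁ on-y) = inj₂ (inj₁ on-y)
swap-Near (inj₂ (inj₁ on-x)) = inj₁ on-x
swap-Near (inj₂ (inj₂ (inj₁ (x< , y>)))) = inj₂ (inj₂ (inj₂ (y> , x<)))
swap-Near (inj₂ (inj₂ (inj₂ (x> , y<)))) = inj₂ (inj₂ (inj₁ (y< , x>)))

swap-Move : ∀ {u v} → Move u v → Move (swap u) (swap v)
swap-Move (inj₁ u≡v) = inj₁ (cong swap u≡v)
swap-Move {u} {v} (inj₂ (u≢v , near)) = inj₂ (u≢v ∘ swap-injective , swap-Near {u} {v} near)

mutual
  swap-RobberToMove : ∀ n c r → RobberToMove n c r → RobberToMove n (swap c) (swap r)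
  swap-RobberToMove n c r win r′ mv
    with win (swap r′) (subst (λ s → Move s (swap r′)) (swap-involutive r) (swap-Move mv))
  ... | inj₁ caught = inj₁ (trans (sym (swap-involutive r′)) (cong swap caught))
  ... | inj₂ cop = inj₂ (subst (CopToMove n (swap c)) (swap-involutive r′)
                                (swap-CopToMove n c (swap r′) cop))

  swap-CopToMove : ∀ n c r → CopToMove n c r → CopToMove n (swap c) (swap r)
  swap-CopToMove (suc n) c r (c′ , mv , inj₁ caught) = swap c′ , swap-Move mv , inj₁ (cong swap caught)
  swap-CopToMove (suc n) c r (c′ , mv , inj₂ win) =
    swap c′ , swap-Move mv , inj₂ (swap-RobberToMove n c′ r win)

yPoint : ℕ → V
yPoint k = (0 , suc k) , _

Move-yPoint : ∀ v k → yc v ≤ k → Move v (yPoint k)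
Move-yPoint v k y≤k with xc v ≟ 0
... | yes x≡0 = Near⇒Move {v} (inj₁ (x≡0 , refl))
... | no x≢0 = Near⇒Move {v} (inj₂ (inj₂ (inj₂ (n≢0⇒n>0 x≢0 , s≤s y≤k))))

reachable-or-above : ∀ k r → Move (yPoint k) r ⊎ (0 < xc r × k < yc r)
reachable-or-above k r with xc r ≟ 0
... | yes x≡0 = inj₁ (Near⇒Move {v = r} (inj₁ (refl , x≡0)))
... | no x≢0 with yc r ≤? k
...   | yes y≤k = inj₁ (Near⇒Move {v = r} (inj₂ (inj₂ (inj₁ (n≢0⇒n>0 x≢0 , s≤s y≤k)))))
...   | no y≰k = inj₂ (n≢0⇒n>0 x≢0 , ≰⇒> y≰k)

chase : ℕ → V → V
chase k r with reachable-or-above k r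
... | inj₁ _ = r
... | inj₂ _ = yPoint (yc r)

chase-legal : ∀ k r → Move (yPoint k) (chase k r)
chase-legal k r with reachable-or-above k r
... | inj₁ reachable = reachable
... | inj₂ (_ , above) = Move-yPoint (yPoint k) (yc r) above

ChaseOutcome : ℕ → V → Set
ChaseOutcome k r = chase k r ≡ r ⊎ (chase k r ≡ yPoint (yc r) × 0 < xc r × k < yc r)

chase-outcome : ∀ k r → ChaseOutcome k r
chase-outcome k r with reachable-or-above k r
... | inj₁ _ = inj₁ refl
... | inj₂ above = inj₂ (refl , above)

-- The hypothesis yc r ≤ k puts the robber strictly below the cop at (0, k + 1).
chase-wins : ∀ n k r → xc r < n → yc r ≤ k → RobberToMove n (yPoint k) r
chase-wins (suc n) k r x<n y≤k r′ mv = inj₂ (chase k r′ , chase-legal k r′ , respond (chase-outcome k r′))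
  where
  respond : ChaseOutcome k r′ → chase k r′ ≡ r′ ⊎ RobberToMove n (chase k r′) r′
  respond (inj₁ caught) = inj₁ caught
  respond (inj₂ (followed , x>0 , above)) =
    inj₂ (subst (λ c → RobberToMove n c r′) (sym followed) (chase-wins n (yc r′) r′ x′<n ≤-refl))
    where
    x′<n : xc r′ < n
    x′<n = <-≤-trans (Move-up⇒left mv x>0 (≤-<-trans y≤k above)) (≤-pred x<n)

yAxis-catches : ∀ n v r → xc r < n → CopToMove (suc n) v r
yAxis-catches n v r x<n =
  yPoint (yc v + yc r) , Move-yPoint v _ (m≤m+n (yc v) (yc r)) ,
  inj₂ (chase-wins n _ r x<n (m≤n+m (yc r) (yc v)))

xAxis-catches : ∀ n v r → yc r < n → CopToMove (suc n) v r
xAxis-catches n v r y<n =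
  subst₂ (CopToMove (suc n)) (swap-involutive v) (swap-involutive r)
         (swap-CopToMove (suc n) (swap v) (swap r) (yAxis-catches n (swap v) (swap r) y<n))

catch-within : ∀ u v → CatchWithin (2 + (xc u + yc u)) v u
catch-within u v = inj₂ λ u′ mv →
  inj₂ ([ yAxis-catches _ v u′ ∘ s≤s , xAxis-catches _ v u′ ∘ s≤s ]′ (Move-bounded mv))

copStep : V → V → V
copStep ((zero , suc k) , _) r = chase k r
copStep c _ = c

copStep-legal : ∀ c r → Move c (copStep c r)
copStep-legal ((zero , suc k) , _) r = chase-legal k r
copStep-legal ((zero , zero) , _) _ = inj₁ refl
copStep-legal ((suc _ , _) , _) _ = inj₁ refl

σ : CopStrategy
σ zero [] = yPoint 0
σ (suc n) (r ∷ h) = copStep (σ n h) r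

σ-legal : LegalCop σ
σ-legal n r h = copStep-legal (σ n h) r

module _ (r : RobberPlay) (legal : LegalRobber r) where

  σ-chases : ∀ m n k → xc (r n) < m → yc (r n) ≤ k → copAt σ r (suc n) ≡ yPoint k → Caught σ r
  σ-chases (suc m) n k x<m y≤k cop≡ = continue (chase-outcome k (r (suc n)))
    where
    next : copAt σ r (suc (suc n)) ≡ chase k (r (suc n))
    next = cong (λ c → copStep c (r (suc n))) cop≡

    continue : ChaseOutcome k (r (suc n)) → Caught σ r
    continue (inj₁ caught) = suc n , inj₂ (trans next caught)
    continue (inj₂ (followed , x>0 , above)) =
      σ-chases m (suc n) (yc (r (suc n))) x′<m ≤-refl (trans next followed)
      where
      x′<m : xc (r (suc n)) < m
      x′<m = <-≤-trans (Move-up⇒left (legal n) x>0 (≤-<-trans y≤k above)) (≤-pred x<m)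

  σ-catches : Caught σ r
  σ-catches with chase-outcome 0 (r 0)
  ... | inj₁ caught = 0 , inj₂ caught
  ... | inj₂ (followed , _) = σ-chases (suc (xc (r 0))) 0 (yc (r 0)) ≤-refl ≤-refl followed

Far : ℕ → V → Set
Far n r = n < xc r × n < yc r

Far-pred : ∀ {n r r′} → Far (suc n) r → xc r ≤ suc (xc r′) → yc r ≤ suc (yc r′) → Far n r′
Far-pred (x> , y>) x≤ y≤ = ≤-pred (≤-trans x> x≤) , ≤-pred (≤-trans y> y≤)

-- Stay when componentwise below the cop.  Otherwise the cop is strictly left of
-- (or below) the robber, who steps one unit left (down) while jumping past both
-- his own and the cop's other coordinate.
flee : ∀ {n} c r → Far (suc n) r → r ≢ c → ∃ λ r′ → Move r r′ × ¬ Move c r′ × Far n r′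
flee c r@((suc (suc x) , suc (suc y)) , _) far@(s≤s (s≤s _) , s≤s (s≤s _)) r≢c
  with xc c ≤? suc x | yc c ≤? suc y
... | yes cx≤ | _ = r′ , Near⇒Move {r} (inj₂ (inj₂ (inj₂ (≤-refl , r<r′))))
                  , comparable⇒¬Move z<s z<s (λ c≡r′ → <-irrefl (cong yc c≡r′) c<r′) (inj₁ (cx≤ , <⇒≤ c<r′))
                  , Far-pred far ≤-refl (m≤n⇒m≤1+n (<⇒≤ r<r′))
  where
  r′ : V
  r′ = (suc x , suc (suc (suc y) + yc c)) , _
  r<r′ : suc (suc y) < yc r′
  r<r′ = s≤s (m≤m+n (suc (suc y)) (yc c))
  c<r′ : yc c < yc r′
  c<r′ = s≤s (m≤n+m (yc c) (suc (suc y)))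
... | no _ | yes cy≤ = r′ , Near⇒Move {r} (inj₂ (inj₂ (inj₁ (r<r′ , ≤-refl))))
                  , comparable⇒¬Move z<s z<s (λ c≡r′ → <-irrefl (cong xc c≡r′) c<r′) (inj₁ (<⇒≤ c<r′ , cy≤))
                  , Far-pred far (m≤n⇒m≤1+n (<⇒≤ r<r′)) ≤-refl
  where
  r′ : V
  r′ = (suc (suc (suc x) + xc c) , suc y) , _
  r<r′ : suc (suc x) < xc r′
  r<r′ = s≤s (m≤m+n (suc (suc x)) (xc c))
  c<r′ : xc c < xc r′
  c<r′ = s≤s (m≤n+m (xc c) (suc (suc x)))
... | no cx≰ | no cy≰ = r , inj₁ refl
                      , comparable⇒¬Move z<s z<s (r≢c ∘ sym) (inj₂ (≰⇒> cx≰ , ≰⇒> cy≰))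
                      , Far-pred far (n≤1+n _) (n≤1+n _)

mutual
  escape : ∀ n c r → r ≢ c → Far (suc n) r → ¬ RobberToMove n c r
  escape n c r r≢c far win with flee c r far r≢c
  ... | r′ , mv , safe , far′ = [ (λ r′≡c → safe (inj₁ (sym r′≡c))) , evade n c r′ safe far′ ]′ (win r′ mv)

  evade : ∀ n c r → ¬ Move c r → Far n r → ¬ CopToMove n c r
  evade (suc n) c r safe _ (c′ , mv , inj₁ c′≡r) = safe (subst (Move c) c′≡r mv)
  evade (suc n) c r safe far (c′ , mv , inj₂ win) =
    escape n c′ r (λ r≡c′ → safe (subst (Move c) (sym r≡c′) mv)) far win

no-uniform-bound : ¬ (∃ λ (n : ℕ) → ∀ (u v : V) → CatchWithin n v u)
no-uniform-bound (n , catch) =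
  [ (λ ()) , escape n (yPoint 0) diagonal (λ ()) (n<1+n (suc n) , n<1+n (suc n)) ]′ (catch diagonal (yPoint 0))
  where
  diagonal : V
  diagonal = (suc (suc n) , suc (suc n)) , _

theorem2 : CopWin
    × (∀ (u v : V) → ∃ λ (n : ℕ) → CatchWithin n v u)
    × ¬ (∃ λ (n : ℕ) → ∀ (u v : V) → CatchWithin n v u)
theorem2 = (σ , σ-legal , σ-catches) , (λ u v → _ , catch-within u v) , no-uniform-bound
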